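{- Let $X=\{X_1,X_2\}$ be a $\lambda_2$-equitable $2$-partition of $J(n,3)$ with quotient matrix $(p_{ij})$ satisfying $p_{11}\geq p_{22}$ and $p_{11}\geq 2n-7$, and assume no vertex is of type (I) or (II). Let $\{a,b,c\}$ be a vertex with $\overline{abc}=1$ such that for every $d\in[n]\setminus\{a,b,c\}$ the triple $(\overline{abd},\overline{acd},\overline{bcd})$ is $(1,1,1)$ or $(0,0,0)$. Then $n\leq 14$.
   Context: $J(n,3)$: vertices are the $3$-subsets of $[n]$, adjacent iff they share exactly two elements; it is $3(n-3)$-regular. An equitable $2$-partition with quotient matrix $(p_{ij})$ means each vertex of $X_i$ has exactly $p_{ij}$ neighbours in $X_j$; $\lambda_2$-equitable means $p_{11}-p_{21}=n-7$. $\overline{u}=1$ if $u\in X_1$, else $0$; $\overline{xyz}=\overline{\{x,y,z\}}$; $\overline{ij\ast}$ is the number of $3$-subsets containing $i,j$ lying in $X_1$. A vertex $v=\{x,y,z\}\in X_1$, labelled so that $\overline{xy\ast}\geq\overline{xz\ast}\geq\overline{yz\ast}$, is of type (I) if $(\overline{xy\ast}-\overline{xz\ast},\overline{xz\ast}-\overline{yz\ast})=(n-4,0)$ and of type (II) if this pair equals $((n-4)/2,(n-4)/2)$. -}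

module Defs where

open import Data.Nat using (ℕ; zero; suc; _+_; _*_; _≟_; _≤_)
open import Data.Bool using (Bool; true; false; _∧_; if_then_else_)
open import Data.Fin using (Fin)
open import Data.Fin.Subset using (Subset; _∩_; _∪_; ⁅_⁆; ∣_∣)
open import Data.Vec using (Vec; []; _∷_; lookup)
open import Data.List using (List; []; _∷_; map; _++_)
open import Relation.Nullary.Decidable using (⌊_⌋)
open import Relation.Nullary using (¬_)
open import Relation.Binary.PropositionalEquality using (_≡_; _≢_)
open import Data.Product using (∃; _×_)

-- Vertices of J(n,3) are the subsets s ⊆ Fin n with ∣ s ∣ = 3.
-- A 2-partition {X₁, X₂} is given by the indicator X₁ : Subset n → Bool
-- (only its values on 3-subsets matter); X₂ is the complement.

allSubsets : (n : ℕ) → List (Subset n)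
allSubsets zero = [] ∷ []
allSubsets (suc n) = map (true ∷_) (allSubsets n) ++ map (false ∷_) (allSubsets n)

countL : ∀ {n} → (Subset n → Bool) → List (Subset n) → ℕ
countL P [] = 0
countL P (s ∷ ss) = (if P s then 1 else 0) + countL P ss

#[_] : ∀ {n} → (Subset n → Bool) → ℕ
#[_] {n} P = countL P (allSubsets n)

isVertex : ∀ {n} → Subset n → Bool
isVertex s = ⌊ ∣ s ∣ ≟ 3 ⌋

adj : ∀ {n} → Subset n → Subset n → Bool
adj s t = ⌊ ∣ s ∩ t ∣ ≟ 2 ⌋

not : Bool → Bool
not true = false
not false = true

nbrs₁ : ∀ {n} → (Subset n → Bool) → Subset n → ℕ
nbrs₁ X₁ s = #[ (λ t → isVertex t ∧ adj s t ∧ X₁ t) ]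

nbrs₂ : ∀ {n} → (Subset n → Bool) → Subset n → ℕ
nbrs₂ X₁ s = #[ (λ t → isVertex t ∧ adj s t ∧ not (X₁ t)) ]

record Equitable (n : ℕ) (X₁ : Subset n → Bool) (p₁₁ p₁₂ p₂₁ p₂₂ : ℕ) : Set where
  field
    nonempty₁ : ∃ λ s → ∣ s ∣ ≡ 3 × X₁ s ≡ true
    nonempty₂ : ∃ λ s → ∣ s ∣ ≡ 3 × X₁ s ≡ false
    row₁ : ∀ s → ∣ s ∣ ≡ 3 → X₁ s ≡ true → nbrs₁ X₁ s ≡ p₁₁ × nbrs₂ X₁ s ≡ p₁₂
    row₂ : ∀ s → ∣ s ∣ ≡ 3 → X₁ s ≡ false → nbrs₁ X₁ s ≡ p₂₁ × nbrs₂ X₁ s ≡ p₂₂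

-- λ₂-equitable: p₁₁ - p₂₁ = n - 7 (as integers)
λ₂-Equitable : (n : ℕ) (X₁ : Subset n → Bool) (p₁₁ p₁₂ p₂₁ p₂₂ : ℕ) → Set
λ₂-Equitable n X₁ p₁₁ p₁₂ p₂₁ p₂₂ =
  Equitable n X₁ p₁₁ p₁₂ p₂₁ p₂₂ × p₁₁ + 7 ≡ p₂₁ + n

triple : ∀ {n} → Fin n → Fin n → Fin n → Subset n
triple x y z = ⁅ x ⁆ ∪ ⁅ y ⁆ ∪ ⁅ z ⁆

Distinct3 : ∀ {n} → Fin n → Fin n → Fin n → Set
Distinct3 x y z = x ≢ y × x ≢ z × y ≢ z

bit : Bool → ℕ
bit true = 1
bit false = 0

ov : ∀ {n} → (Subset n → Bool) → Fin n → Fin n → Fin n → ℕ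
ov X₁ x y z = bit (X₁ (triple x y z))

ov₂ : ∀ {n} → (Subset n → Bool) → Fin n → Fin n → ℕ
ov₂ X₁ i j = #[ (λ t → isVertex t ∧ lookup t i ∧ lookup t j ∧ X₁ t) ]

-- For v = {x,y,z} ∈ X₁ labelled so that ov₂ x y ≥ ov₂ x z ≥ ov₂ y z:
-- type (I): (ov₂ x y - ov₂ x z , ov₂ x z - ov₂ y z) = (n-4, 0)
TypeI : ∀ n → (Subset n → Bool) → Fin n → Fin n → Fin n → Set
TypeI n X₁ x y z = ov₂ X₁ x y + 4 ≡ ov₂ X₁ x z + n × ov₂ X₁ x z ≡ ov₂ X₁ y z

-- type (II): the pair equals ((n-4)/2, (n-4)/2)  (differences doubled, exact over ℚ)
TypeII : ∀ n → (Subset n → Bool) → Fin n → Fin n → Fin n → Set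
TypeII n X₁ x y z =
  2 * ov₂ X₁ x y + 4 ≡ 2 * ov₂ X₁ x z + n × 2 * ov₂ X₁ x z + 4 ≡ 2 * ov₂ X₁ y z + n

NoTypeI-II : ∀ n → (Subset n → Bool) → Set
NoTypeI-II n X₁ = ∀ (x y z : Fin n) → Distinct3 x y z → X₁ (triple x y z) ≡ true →
  ov₂ X₁ x z ≤ ov₂ X₁ x y → ov₂ X₁ y z ≤ ov₂ X₁ x z →
  ¬ TypeI n X₁ x y z × ¬ TypeII n X₁ x y z

module Submission where

-- Double counting the vertices through two points of a vertex v = {x,y,z} gives
-- ov(xy*) + ov(xz*) + ov(yz*) = (neighbours of v in X₁) + 3·[v ∈ X₁], i.e. p₁₁ + 3 on X₁ and p₂₁ on X₂.
-- The hypothesis on {a,b,c} gives ov(ab*) = ov(ac*) = ov(bc*) = U, so p₁₁ + 3 = 3U, and comparing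
-- {a,b,d}, {a,c,d}, {b,c,d} shows ov(ad*) = ov(bd*) = ov(cd*) for every d ∉ {a,b,c}.
-- If some {a,b,d} lies in X₂, λ₂-equitability gives 2U + 4 = 2·ov(ad*) + n; a vertex {a,d,e} in X₁ would
-- then be of type (II) or force n ≤ 5, so ov(ad*) = 0, which contradicts 2n ≤ p₁₁ + 7.
-- Otherwise U = n - 2, which makes ov(xy*) vanish on every pair of a vertex of X₂; then p₂₁ = 0,
-- contradicting λ₂. So the hypotheses in fact force n ≤ 5.

open import Defs
import Data.Nat
open import Data.Nat using (ℕ; zero; suc; _+_; _*_; _≤_; _<_; z≤n; s≤s; _≤?_; _<?_; ⌊_/2⌋)
open import Data.Nat.Properties hiding (_≟_)
open import Data.Bool using (Bool; true; false; _∧_; _∨_; if_then_else_)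
open import Data.Bool.Properties using (∨-zeroʳ)
import Data.Bool as Bool
open import Data.Fin using (Fin; zero; suc)
open import Data.Fin.Properties using (_≟_; any?)
import Data.Fin.Properties as Fin
open import Data.Fin.Subset using (Subset; _∩_; _∪_; ⁅_⁆; ∣_∣; _∉_)
  renaming (⊥ to ∅)
open import Data.Fin.Subset.Properties using (_∈?_; ∪-assoc; ∪-comm; ∪-identityˡ; x∈⁅x⁆; x∈⁅y⁆⇒x≡y)
open import Data.Vec using ([]; _∷_; lookup)
open import Data.Vec.Properties using (tabulate∘lookup; tabulate-cong; lookup-zipWith; lookup-replicate; []=⇒lookup; lookup⇒[]=)
open import Data.List using (List; []; _∷_; map; _++_)
open import Data.List.Properties using (map-cong; map-++; map-∘)
import Data.Nat.ListAction as List
import Data.Nat.ListAction.Properties as List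
open import Data.Product using (∃; _×_; _,_; proj₁; proj₂)
open import Data.Sum using (_⊎_; inj₁; inj₂)
open import Data.Empty using (⊥; ⊥-elim)
open import Relation.Nullary using (¬?; yes; no)
open import Relation.Nullary.Decidable using (⌊_⌋; _×-dec_; dec-true; dec-false; isYes≗does; ⌊⌋-map′)
open import Relation.Binary.PropositionalEquality
open import Algebra.Properties.CommutativeMonoid.Sum +-0-commutativeMonoid
  using (sum; sum-cong-≗; ∑-distrib-+; sum-replicate-zero)
open import Data.Nat.Tactic.RingSolver using (solve-∀)

private
  variable
    n : ℕ

bit≤1 : ∀ b → bit b ≤ 1
bit≤1 true = s≤s z≤n
bit≤1 false = z≤n

bit≡1⇒true : ∀ {b} → bit b ≡ 1 → b ≡ true
bit≡1⇒true {true} _ = refl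

bit>0⇒true : ∀ {b} → 0 < bit b → b ≡ true
bit>0⇒true {true} _ = refl

bit-injective : ∀ {β γ} → bit β ≡ bit γ → β ≡ γ
bit-injective {true} {true} _ = refl
bit-injective {false} {false} _ = refl

≢⇒≟≡false : {i x : Fin n} → i ≢ x → ⌊ i ≟ x ⌋ ≡ false
≢⇒≟≡false {i = i} {x} i≢x = trans (isYes≗does (i ≟ x)) (dec-false (i ≟ x) i≢x)

≟-refl : (x : Fin n) → ⌊ x ≟ x ⌋ ≡ true
≟-refl x = trans (isYes≗does (x ≟ x)) (dec-true (x ≟ x) refl)

-- Sums over Fin n

sum-zero : {f : Fin n → ℕ} → (∀ i → f i ≡ 0) → sum f ≡ 0
sum-zero {n} f≡0 = trans (sum-cong-≗ f≡0) (sum-replicate-zero n)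

sum-mono-≤ : {f g : Fin n → ℕ} → (∀ i → f i ≤ g i) → sum f ≤ sum g
sum-mono-≤ {zero} f≤g = z≤n
sum-mono-≤ {suc n} f≤g = +-mono-≤ (f≤g zero) (sum-mono-≤ (λ i → f≤g (suc i)))

sum-const-1 : ∀ n → sum {n} (λ _ → 1) ≡ n
sum-const-1 zero = refl
sum-const-1 (suc n) = cong suc (sum-const-1 n)

sum>0⇒∃ : (f : Fin n → ℕ) → 0 < sum f → ∃ λ i → 0 < f i
sum>0⇒∃ {suc n} f 0<Σ with f zero in eq
... | suc _ = zero , subst (0 <_) (sym eq) (s≤s z≤n)
... | zero with sum>0⇒∃ (λ i → f (suc i)) 0<Σ
...   | i , 0<fi = suc i , 0<fi

sum-indicator : (z : Fin n) (f : Fin n → ℕ) → sum (λ i → if ⌊ i ≟ z ⌋ then f i else 0) ≡ f z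
sum-indicator {suc n} zero f = trans (cong (f zero +_) (sum-zero {n} (λ _ → refl))) (+-identityʳ (f zero))
sum-indicator {suc n} (suc z) f = begin
  sum (λ i → if ⌊ suc i ≟ suc z ⌋ then f (suc i) else 0)
    ≡⟨ sum-cong-≗ (λ i → cong (if_then f (suc i) else 0) (⌊⌋-map′ (cong suc) Fin.suc-injective (i ≟ z))) ⟩
  sum (λ i → if ⌊ i ≟ z ⌋ then f (suc i) else 0)          ≡⟨ sum-indicator z (λ i → f (suc i)) ⟩
  f (suc z)                                               ∎
  where open ≡-Reasoning

sumOutside : Subset n → (Fin n → ℕ) → ℕ
sumOutside s f = sum λ i → if lookup s i then 0 else f i

∉⇒lookup≡false : {s : Subset n} {x : Fin n} → x ∉ s → lookup s x ≡ false
∉⇒lookup≡false {s = s} {x} x∉s with lookup s x in eq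
... | true = ⊥-elim (x∉s (lookup⇒[]= x s eq))
... | false = refl

lookup≡false⇒∉ : {s : Subset n} {x : Fin n} → lookup s x ≡ false → x ∉ s
lookup≡false⇒∉ s[x]≡false x∈s with () ← trans (sym ([]=⇒lookup x∈s)) s[x]≡false

lookup-⁅⁆ : (x i : Fin n) → lookup ⁅ x ⁆ i ≡ ⌊ i ≟ x ⌋
lookup-⁅⁆ x i with i ≟ x
... | yes refl = []=⇒lookup (x∈⁅x⁆ i)
... | no i≢x = ∉⇒lookup≡false (λ i∈⁅x⁆ → i≢x (x∈⁅y⁆⇒x≡y x i∈⁅x⁆))

lookup-∪ : (s t : Subset n) (i : Fin n) → lookup (s ∪ t) i ≡ (lookup s i ∨ lookup t i)
lookup-∪ s t i = lookup-zipWith _∨_ i s t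

lookup-ext : {s t : Subset n} → (∀ i → lookup s i ≡ lookup t i) → s ≡ t
lookup-ext {s = s} {t} s≗t =
  trans (sym (tabulate∘lookup s)) (trans (tabulate-cong s≗t) (tabulate∘lookup t))

indicator : Subset n → Fin n → ℕ
indicator t i = bit (lookup t i)

∣∣≡sum-indicator : (t : Subset n) → ∣ t ∣ ≡ sum (indicator t)
∣∣≡sum-indicator [] = refl
∣∣≡sum-indicator (true ∷ t) = cong suc (∣∣≡sum-indicator t)
∣∣≡sum-indicator (false ∷ t) = ∣∣≡sum-indicator t

sum≡sumOutside-∅ : (f : Fin n → ℕ) → sum f ≡ sumOutside ∅ f
sum≡sumOutside-∅ f = sum-cong-≗ (λ i → cong (if_then 0 else f i) (sym (lookup-replicate i false)))

sumOutside-congʳ : (s : Subset n) {f g : Fin n → ℕ} →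
  (∀ i → lookup s i ≡ false → f i ≡ g i) → sumOutside s f ≡ sumOutside s g
sumOutside-congʳ s {f} {g} f≡g = sum-cong-≗ pointwise
  where
  pointwise : ∀ i → (if lookup s i then 0 else f i) ≡ (if lookup s i then 0 else g i)
  pointwise i with lookup s i in eq
  ... | true = refl
  ... | false = f≡g i eq

sumOutside-zero : (s : Subset n) {f : Fin n → ℕ} →
  (∀ i → lookup s i ≡ false → f i ≡ 0) → sumOutside s f ≡ 0
sumOutside-zero s f≡0 = trans (sumOutside-congʳ s f≡0) (sum-zero (λ i → if-zero (lookup s i)))
  where
  if-zero : ∀ b → (if b then 0 else 0) ≡ 0
  if-zero true = refl
  if-zero false = refl

sumOutside-mono : (s : Subset n) {f g : Fin n → ℕ} →
  (∀ i → f i ≤ g i) → sumOutside s f ≤ sumOutside s g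
sumOutside-mono s {f} {g} f≤g = sum-mono-≤ pointwise
  where
  pointwise : ∀ i → (if lookup s i then 0 else f i) ≤ (if lookup s i then 0 else g i)
  pointwise i with lookup s i
  ... | true = z≤n
  ... | false = f≤g i

sumOutside-∪⁅⁆ : (s : Subset n) {z : Fin n} (f : Fin n → ℕ) → lookup s z ≡ false →
  sumOutside s f ≡ f z + sumOutside (s ∪ ⁅ z ⁆) f
sumOutside-∪⁅⁆ s {z} f s[z]≡false = begin
  sumOutside s f                                                           ≡⟨ sum-cong-≗ split ⟩
  sum (λ i → (if ⌊ i ≟ z ⌋ then f i else 0) + (if lookup (s ∪ ⁅ z ⁆) i then 0 else f i))
    ≡⟨ ∑-distrib-+ (λ i → if ⌊ i ≟ z ⌋ then f i else 0) _ ⟩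
  sum (λ i → if ⌊ i ≟ z ⌋ then f i else 0) + sumOutside (s ∪ ⁅ z ⁆) f    ≡⟨ cong (_+ sumOutside (s ∪ ⁅ z ⁆) f) (sum-indicator z f) ⟩
  f z + sumOutside (s ∪ ⁅ z ⁆) f                                            ∎
  where
  open ≡-Reasoning
  split : ∀ i → (if lookup s i then 0 else f i) ≡
                (if ⌊ i ≟ z ⌋ then f i else 0) + (if lookup (s ∪ ⁅ z ⁆) i then 0 else f i)
  split i rewrite lookup-∪ s ⁅ z ⁆ i | lookup-⁅⁆ z i with i ≟ z
  ... | yes refl rewrite s[z]≡false = sym (+-identityʳ (f i))
  ... | no _ with lookup s i
  ...   | true = refl
  ...   | false = refl

sumOutside-≥ : (s : Subset n) (f : Fin n → ℕ) {i : Fin n} → lookup s i ≡ false → f i ≤ sumOutside s f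
sumOutside-≥ s f {i} s[i]≡false rewrite sumOutside-∪⁅⁆ s f s[i]≡false = m≤m+n (f i) _

sumOutside>0⇒∃ : (s : Subset n) (f : Fin n → ℕ) → 0 < sumOutside s f →
  ∃ λ i → lookup s i ≡ false × 0 < f i
sumOutside>0⇒∃ s f 0<Σ with sum>0⇒∃ _ 0<Σ
... | i , 0<fi with lookup s i in s[i]
...   | false = i , s[i] , 0<fi

-- Pairs and triples

pair : Fin n → Fin n → Subset n
pair x y = ⁅ x ⁆ ∪ ⁅ y ⁆

pair∋₁ : (x y : Fin n) → lookup (pair x y) x ≡ true
pair∋₁ x y rewrite lookup-∪ ⁅ x ⁆ ⁅ y ⁆ x | lookup-⁅⁆ x x | ≟-refl x = refl

pair∋₂ : (x y : Fin n) → lookup (pair x y) y ≡ true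
pair∋₂ x y rewrite lookup-∪ ⁅ x ⁆ ⁅ y ⁆ y | lookup-⁅⁆ y y | ≟-refl y = ∨-zeroʳ (lookup ⁅ x ⁆ y)

pair∌ : {x y i : Fin n} → i ≢ x → i ≢ y → lookup (pair x y) i ≡ false
pair∌ {x = x} {y} {i} i≢x i≢y
  rewrite lookup-∪ ⁅ x ⁆ ⁅ y ⁆ i | lookup-⁅⁆ x i | lookup-⁅⁆ y i
        | ≢⇒≟≡false i≢x | ≢⇒≟≡false i≢y = refl

pair∌⇒≢ : (x y : Fin n) {e : Fin n} → lookup (pair x y) e ≡ false → e ≢ x × e ≢ y
pair∌⇒≢ x y pair∌e =
  (λ { refl → true≢false (trans (sym (pair∋₁ x y)) pair∌e) }) ,
  (λ { refl → true≢false (trans (sym (pair∋₂ x y)) pair∌e) })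
  where
  true≢false : true ≢ false
  true≢false ()

lookup-triple : (x y z i : Fin n) →
  lookup (triple x y z) i ≡ (⌊ i ≟ x ⌋ ∨ ⌊ i ≟ y ⌋ ∨ ⌊ i ≟ z ⌋)
lookup-triple x y z i = begin
  lookup (⁅ x ⁆ ∪ ⁅ y ⁆ ∪ ⁅ z ⁆) i                    ≡⟨ lookup-∪ ⁅ x ⁆ _ i ⟩
  lookup ⁅ x ⁆ i ∨ lookup (⁅ y ⁆ ∪ ⁅ z ⁆) i          ≡⟨ cong₂ _∨_ (lookup-⁅⁆ x i) (lookup-∪ ⁅ y ⁆ _ i) ⟩
  ⌊ i ≟ x ⌋ ∨ lookup ⁅ y ⁆ i ∨ lookup ⁅ z ⁆ i        ≡⟨ cong₂ (λ u v → ⌊ i ≟ x ⌋ ∨ u ∨ v) (lookup-⁅⁆ y i) (lookup-⁅⁆ z i) ⟩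
  ⌊ i ≟ x ⌋ ∨ ⌊ i ≟ y ⌋ ∨ ⌊ i ≟ z ⌋                  ∎
  where open ≡-Reasoning

triple-swap₁₂ : (x y z : Fin n) → triple x y z ≡ triple y x z
triple-swap₁₂ x y z = begin
  ⁅ x ⁆ ∪ ⁅ y ⁆ ∪ ⁅ z ⁆      ≡⟨ ∪-assoc ⁅ x ⁆ ⁅ y ⁆ ⁅ z ⁆ ⟨
  (⁅ x ⁆ ∪ ⁅ y ⁆) ∪ ⁅ z ⁆    ≡⟨ cong (_∪ ⁅ z ⁆) (∪-comm ⁅ x ⁆ ⁅ y ⁆) ⟩
  (⁅ y ⁆ ∪ ⁅ x ⁆) ∪ ⁅ z ⁆    ≡⟨ ∪-assoc ⁅ y ⁆ ⁅ x ⁆ ⁅ z ⁆ ⟩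
  ⁅ y ⁆ ∪ ⁅ x ⁆ ∪ ⁅ z ⁆      ∎
  where open ≡-Reasoning

triple-swap₂₃ : (x y z : Fin n) → triple x y z ≡ triple x z y
triple-swap₂₃ x y z = cong (⁅ x ⁆ ∪_) (∪-comm ⁅ y ⁆ ⁅ z ⁆)

triple-rotate : (x y z : Fin n) → triple x y z ≡ triple y z x
triple-rotate x y z = trans (triple-swap₁₂ x y z) (triple-swap₂₃ y x z)

triple∋₁ : (x y z : Fin n) → lookup (triple x y z) x ≡ true
triple∋₁ x y z rewrite lookup-triple x y z x | ≟-refl x = refl

triple∋₂ : (x y z : Fin n) → lookup (triple x y z) y ≡ true
triple∋₂ x y z = subst (λ s → lookup s y ≡ true) (triple-swap₁₂ y x z) (triple∋₁ y x z)

triple∋₃ : (x y z : Fin n) → lookup (triple x y z) z ≡ true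
triple∋₃ x y z = subst (λ s → lookup s z ≡ true) (triple-swap₂₃ x z y) (triple∋₂ x z y)

triple∌ : {x y z i : Fin n} → i ≢ x → i ≢ y → i ≢ z → lookup (triple x y z) i ≡ false
triple∌ {x = x} {y} {z} {i} i≢x i≢y i≢z
  rewrite lookup-triple x y z i | ≢⇒≟≡false i≢x | ≢⇒≟≡false i≢y | ≢⇒≟≡false i≢z = refl

∉triple⇒≢ : {x y z d : Fin n} → d ∉ triple x y z → d ≢ x × d ≢ y × d ≢ z
∉triple⇒≢ {x = x} {y} {z} d∉ =
  (λ { refl → d∉ (lookup⇒[]= _ _ (triple∋₁ x y z)) }) ,
  (λ { refl → d∉ (lookup⇒[]= _ _ (triple∋₂ x y z)) }) ,
  (λ { refl → d∉ (lookup⇒[]= _ _ (triple∋₃ x y z)) })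

sum-split-pair : {x y : Fin n} (f : Fin n → ℕ) → x ≢ y → sum f ≡ f x + f y + sumOutside (pair x y) f
sum-split-pair {x = x} {y} f x≢y = begin
  sum f                                          ≡⟨ sum≡sumOutside-∅ f ⟩
  sumOutside ∅ f                                 ≡⟨ sumOutside-∪⁅⁆ ∅ f (lookup-replicate x false) ⟩
  f x + sumOutside (∅ ∪ ⁅ x ⁆) f                 ≡⟨ cong (λ s → f x + sumOutside s f) (∪-identityˡ ⁅ x ⁆) ⟩
  f x + sumOutside ⁅ x ⁆ f                       ≡⟨ cong (f x +_) (sumOutside-∪⁅⁆ ⁅ x ⁆ f y∉⁅x⁆) ⟩
  f x + (f y + sumOutside (pair x y) f)          ≡⟨ +-assoc (f x) (f y) _ ⟨
  f x + f y + sumOutside (pair x y) f            ∎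
  where
  open ≡-Reasoning
  y∉⁅x⁆ : lookup ⁅ x ⁆ y ≡ false
  y∉⁅x⁆ = trans (lookup-⁅⁆ x y) (≢⇒≟≡false (λ y≡x → x≢y (sym y≡x)))

sumOutside-pair-split : {x y z : Fin n} (f : Fin n → ℕ) → z ≢ x → z ≢ y →
  sumOutside (pair x y) f ≡ f z + sumOutside (triple x y z) f
sumOutside-pair-split {x = x} {y} {z} f z≢x z≢y =
  trans (sumOutside-∪⁅⁆ (pair x y) f (pair∌ z≢x z≢y))
        (cong (λ s → f z + sumOutside s f) (∪-assoc ⁅ x ⁆ ⁅ y ⁆ ⁅ z ⁆))

sum-split-triple : {x y z : Fin n} (f : Fin n → ℕ) → Distinct3 x y z →
  sum f ≡ f x + f y + f z + sumOutside (triple x y z) f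
sum-split-triple {x = x} {y} {z} f (x≢y , x≢z , y≢z) = begin
  sum f                                              ≡⟨ sum-split-pair f x≢y ⟩
  f x + f y + sumOutside (pair x y) f                ≡⟨ cong (f x + f y +_) (sumOutside-pair-split f (≢-sym x≢z) (≢-sym y≢z)) ⟩
  f x + f y + (f z + sumOutside (triple x y z) f)    ≡⟨ +-assoc (f x + f y) (f z) _ ⟨
  f x + f y + f z + sumOutside (triple x y z) f      ∎
  where open ≡-Reasoning

sumOutside-pair-1 : {x y : Fin n} → x ≢ y → sumOutside (pair x y) (λ _ → 1) + 2 ≡ n
sumOutside-pair-1 {n} x≢y =
  trans (+-comm _ 2) (trans (sym (sum-split-pair (λ _ → 1) x≢y)) (sum-const-1 n))

sumOutside-triple-1 : {x y z : Fin n} → Distinct3 x y z → sumOutside (triple x y z) (λ _ → 1) + 3 ≡ n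
sumOutside-triple-1 {n} xyz =
  trans (+-comm _ 3) (trans (sym (sum-split-triple (λ _ → 1) xyz)) (sum-const-1 n))

∣triple∣≡3 : {x y z : Fin n} → Distinct3 x y z → ∣ triple x y z ∣ ≡ 3
∣triple∣≡3 {x = x} {y} {z} xyz = begin
  ∣ T ∣                                                                   ≡⟨ ∣∣≡sum-indicator T ⟩
  sum (indicator T)                                                       ≡⟨ sum-split-triple (indicator T) xyz ⟩
  indicator T x + indicator T y + indicator T z + sumOutside T (indicator T)
    ≡⟨ cong₂ _+_ (cong₂ _+_ (cong₂ _+_ (cong bit (triple∋₁ x y z)) (cong bit (triple∋₂ x y z))) (cong bit (triple∋₃ x y z)))
                 (sumOutside-zero T (λ i T[i]≡false → cong bit T[i]≡false)) ⟩
  3                                                                       ∎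
  where
  open ≡-Reasoning
  T = triple x y z

⊇triple⇒≡triple : {x y z : Fin n} (t : Subset n) → Distinct3 x y z → ∣ t ∣ ≡ 3 →
  lookup t x ≡ true → lookup t y ≡ true → lookup t z ≡ true → t ≡ triple x y z
⊇triple⇒≡triple {x = x} {y} {z} t xyz ∣t∣≡3 t∋x t∋y t∋z = lookup-ext agree
  where
  rest≡0 : sumOutside (triple x y z) (indicator t) ≡ 0
  rest≡0 = +-cancelˡ-≡ 3 _ 0 (sym (begin
    3                                                                      ≡⟨ ∣t∣≡3 ⟨
    ∣ t ∣                                                                  ≡⟨ ∣∣≡sum-indicator t ⟩
    sum (indicator t)                                                      ≡⟨ sum-split-triple (indicator t) xyz ⟩
    indicator t x + indicator t y + indicator t z + sumOutside (triple x y z) (indicator t)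
      ≡⟨ cong (λ k → k + sumOutside (triple x y z) (indicator t))
              (cong₂ _+_ (cong₂ _+_ (cong bit t∋x) (cong bit t∋y)) (cong bit t∋z)) ⟩
    3 + sumOutside (triple x y z) (indicator t)                           ∎))
    where open ≡-Reasoning
  agree : ∀ i → lookup t i ≡ lookup (triple x y z) i
  agree i with i ≟ x | i ≟ y | i ≟ z
  ... | yes refl | _ | _ = trans t∋x (sym (triple∋₁ x y z))
  ... | _ | yes refl | _ = trans t∋y (sym (triple∋₂ x y z))
  ... | _ | _ | yes refl = trans t∋z (sym (triple∋₃ x y z))
  ... | no i≢x | no i≢y | no i≢z with triple∌ i≢x i≢y i≢z
  ...   | T[i]≡false with lookup t i in t[i]
  ...     | false = sym T[i]≡false
  ...     | true with () ← subst (_≤ 0) (cong bit t[i])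
                         (subst (indicator t i ≤_) rest≡0 (sumOutside-≥ (triple x y z) (indicator t) T[i]≡false))

∉∪⁅⁆⇒ : (s : Subset n) {x i : Fin n} → lookup (s ∪ ⁅ x ⁆) i ≡ false → lookup s i ≡ false × i ≢ x
∉∪⁅⁆⇒ s {x} {i} s∪x[i]≡false
  rewrite lookup-∪ s ⁅ x ⁆ i | lookup-⁅⁆ x i with lookup s i | i ≟ x
... | false | no i≢x = refl , i≢x

peel : (t s : Subset n) {k : ℕ} → sumOutside s (indicator t) ≡ suc k →
  ∃ λ i → lookup s i ≡ false × lookup t i ≡ true × sumOutside (s ∪ ⁅ i ⁆) (indicator t) ≡ k
peel t s {k} Σ≡1+k with sumOutside>0⇒∃ s (indicator t) (subst (0 <_) (sym Σ≡1+k) (s≤s z≤n))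
... | i , s∌i , 0<t[i] = i , s∌i , t∋i , suc-injective (begin
  suc (sumOutside (s ∪ ⁅ i ⁆) (indicator t))          ≡⟨ cong (_+ sumOutside (s ∪ ⁅ i ⁆) (indicator t)) (cong bit t∋i) ⟨
  indicator t i + sumOutside (s ∪ ⁅ i ⁆) (indicator t) ≡⟨ sumOutside-∪⁅⁆ s (indicator t) s∌i ⟨
  sumOutside s (indicator t)                           ≡⟨ Σ≡1+k ⟩
  suc k                                                ∎)
  where
  open ≡-Reasoning
  t∋i : lookup t i ≡ true
  t∋i = bit>0⇒true 0<t[i]

3-subset⇒triple : (t : Subset n) → ∣ t ∣ ≡ 3 →
  ∃ λ x → ∃ λ y → ∃ λ z → Distinct3 x y z × t ≡ triple x y z
3-subset⇒triple t ∣t∣≡3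
  with peel t ∅ (trans (sym (trans (∣∣≡sum-indicator t) (sum≡sumOutside-∅ (indicator t)))) ∣t∣≡3)
... | x , _ , t∋x , Σ≡2
  with peel t (∅ ∪ ⁅ x ⁆) Σ≡2
...   | y , y∉ , t∋y , Σ≡1
  with peel t ((∅ ∪ ⁅ x ⁆) ∪ ⁅ y ⁆) Σ≡1
...     | z , z∉ , t∋z , _ = x , y , z , xyz , ⊇triple⇒≡triple t xyz ∣t∣≡3 t∋x t∋y t∋z
  where
  xyz : Distinct3 x y z
  xyz = ≢-sym (proj₂ (∉∪⁅⁆⇒ ∅ y∉)) ,
        ≢-sym (proj₂ (∉∪⁅⁆⇒ ∅ (proj₁ (∉∪⁅⁆⇒ (∅ ∪ ⁅ x ⁆) z∉)))) ,
        ≢-sym (proj₂ (∉∪⁅⁆⇒ (∅ ∪ ⁅ x ⁆) z∉))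

∣triple∩∣ : {x y z : Fin n} (t : Subset n) → Distinct3 x y z →
  ∣ triple x y z ∩ t ∣ ≡ indicator t x + indicator t y + indicator t z
∣triple∩∣ {x = x} {y} {z} t xyz = begin
  ∣ T ∩ t ∣                                                                            ≡⟨ ∣∣≡sum-indicator (T ∩ t) ⟩
  sum (indicator (T ∩ t))                                                              ≡⟨ sum-split-triple (indicator (T ∩ t)) xyz ⟩
  indicator (T ∩ t) x + indicator (T ∩ t) y + indicator (T ∩ t) z + sumOutside T (indicator (T ∩ t))
    ≡⟨ cong₂ _+_ (cong₂ _+_ (cong₂ _+_ (inside (triple∋₁ x y z)) (inside (triple∋₂ x y z))) (inside (triple∋₃ x y z)))
                 (sumOutside-zero T outside) ⟩
  indicator t x + indicator t y + indicator t z + 0                                   ≡⟨ +-identityʳ _ ⟩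
  indicator t x + indicator t y + indicator t z                                       ∎
  where
  open ≡-Reasoning
  T = triple x y z
  inside : ∀ {i} → lookup T i ≡ true → indicator (T ∩ t) i ≡ indicator t i
  inside {i} T∋i rewrite lookup-zipWith _∧_ i T t | T∋i = refl
  outside : ∀ i → lookup T i ≡ false → indicator (T ∩ t) i ≡ 0
  outside i T∌i rewrite lookup-zipWith _∧_ i T t | T∌i = refl

-- Sums over all subsets

sumSubsets : (Subset n → ℕ) → ℕ
sumSubsets {n} g = List.sum (map g (allSubsets n))

#≡sumSubsets : (P : Subset n → Bool) → #[ P ] ≡ sumSubsets (λ t → bit (P t))
#≡sumSubsets {n} P = go (allSubsets n)
  where
  go : (ts : List (Subset n)) → countL P ts ≡ List.sum (map (λ t → bit (P t)) ts)
  go [] = refl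
  go (t ∷ ts) with P t
  ... | true = cong suc (go ts)
  ... | false = go ts

sumSubsets-cong : {g h : Subset n → ℕ} → (∀ t → g t ≡ h t) → sumSubsets g ≡ sumSubsets h
sumSubsets-cong {n} g≗h = cong List.sum (map-cong g≗h (allSubsets n))

sum-map-+ : {A : Set} (g h : A → ℕ) (xs : List A) →
  List.sum (map (λ t → g t + h t) xs) ≡ List.sum (map g xs) + List.sum (map h xs)
sum-map-+ g h [] = refl
sum-map-+ g h (x ∷ xs) rewrite sum-map-+ g h xs = +-assoc-middle (g x) (h x) _ _
  where
  +-assoc-middle : ∀ a b c d → a + b + (c + d) ≡ a + c + (b + d)
  +-assoc-middle = solve-∀

sumSubsets-+ : (g h : Subset n → ℕ) → sumSubsets (λ t → g t + h t) ≡ sumSubsets g + sumSubsets h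
sumSubsets-+ {n} g h = sum-map-+ g h (allSubsets n)

sum-map-* : {A : Set} (k : ℕ) (g : A → ℕ) (xs : List A) →
  List.sum (map (λ t → k * g t) xs) ≡ k * List.sum (map g xs)
sum-map-* k g [] = sym (*-zeroʳ k)
sum-map-* k g (x ∷ xs) = trans (cong (k * g x +_) (sum-map-* k g xs)) (sym (*-distribˡ-+ k (g x) _))

sum-map-zero : {A : Set} {g : A → ℕ} → (∀ t → g t ≡ 0) → (xs : List A) → List.sum (map g xs) ≡ 0
sum-map-zero g≡0 [] = refl
sum-map-zero g≡0 (x ∷ xs) = cong₂ _+_ (g≡0 x) (sum-map-zero g≡0 xs)

sum-map-sum : {A : Set} {m : ℕ} (G : A → Fin m → ℕ) (xs : List A) →
  List.sum (map (λ t → sum (G t)) xs) ≡ sum (λ e → List.sum (map (λ t → G t e) xs))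
sum-map-sum {m = m} G [] = sym (sum-zero {m} (λ _ → refl))
sum-map-sum G (x ∷ xs) =
  trans (cong (sum (G x) +_) (sum-map-sum G xs)) (sym (∑-distrib-+ (G x) _))

sumSubsets-sum : {m : ℕ} (G : Subset n → Fin m → ℕ) →
  sumSubsets (λ t → sum (G t)) ≡ sum (λ e → sumSubsets (λ t → G t e))
sumSubsets-sum {n} G = sum-map-sum G (allSubsets n)

sumSubsets-suc : (g : Subset (suc n) → ℕ) →
  sumSubsets g ≡ sumSubsets (λ t → g (true ∷ t)) + sumSubsets (λ t → g (false ∷ t))
sumSubsets-suc {n} g = begin
  List.sum (map g (map (true ∷_) ts ++ map (false ∷_) ts))
    ≡⟨ cong List.sum (map-++ g (map (true ∷_) ts) _) ⟩
  List.sum (map g (map (true ∷_) ts) ++ map g (map (false ∷_) ts))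
    ≡⟨ List.sum-++ (map g (map (true ∷_) ts)) _ ⟩
  List.sum (map g (map (true ∷_) ts)) + List.sum (map g (map (false ∷_) ts))
    ≡⟨ cong₂ (λ u v → List.sum u + List.sum v) (map-∘ ts) (map-∘ ts) ⟨
  sumSubsets (λ t → g (true ∷ t)) + sumSubsets (λ t → g (false ∷ t))
    ∎
  where
  open ≡-Reasoning
  ts = allSubsets n

sumSubsets-unique : (s : Subset n) (g : Subset n → ℕ) → (∀ t → t ≢ s → g t ≡ 0) → sumSubsets g ≡ g s
sumSubsets-unique [] g g≡0 = +-identityʳ (g [])
sumSubsets-unique {suc n} (true ∷ s) g g≡0 = begin
  sumSubsets g                                                       ≡⟨ sumSubsets-suc g ⟩
  sumSubsets (λ t → g (true ∷ t)) + sumSubsets (λ t → g (false ∷ t))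
    ≡⟨ cong₂ _+_ (sumSubsets-unique s _ (λ t t≢s → g≡0 _ (λ { refl → t≢s refl })))
                 (sum-map-zero (λ t → g≡0 _ (λ ())) (allSubsets n)) ⟩
  g (true ∷ s) + 0                                                   ≡⟨ +-identityʳ _ ⟩
  g (true ∷ s)                                                       ∎
  where open ≡-Reasoning
sumSubsets-unique {suc n} (false ∷ s) g g≡0 = begin
  sumSubsets g                                                       ≡⟨ sumSubsets-suc g ⟩
  sumSubsets (λ t → g (true ∷ t)) + sumSubsets (λ t → g (false ∷ t))
    ≡⟨ cong₂ _+_ (sum-map-zero (λ t → g≡0 _ (λ ())) (allSubsets n))
                 (sumSubsets-unique s _ (λ t t≢s → g≡0 _ (λ { refl → t≢s refl }))) ⟩
  g (false ∷ s)                                                      ∎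
  where open ≡-Reasoning

-- Pair counts ov₂

isVertex⇒∣∣≡3 : (t : Subset n) → isVertex t ≡ true → ∣ t ∣ ≡ 3
isVertex⇒∣∣≡3 t isV with ∣ t ∣ Data.Nat.≟ 3
... | yes ∣t∣≡3 = ∣t∣≡3

isVertex-triple : {x y z : Fin n} → Distinct3 x y z → isVertex (triple x y z) ≡ true
isVertex-triple xyz rewrite ∣triple∣≡3 xyz = refl

through : (Subset n → Bool) → Fin n → Fin n → Subset n → ℕ
through X x y t = bit (isVertex t ∧ lookup t x ∧ lookup t y ∧ X t)

ov₂≡sumSubsets-through : (X : Subset n → Bool) (x y : Fin n) → ov₂ X x y ≡ sumSubsets (through X x y)
ov₂≡sumSubsets-through X x y = #≡sumSubsets (λ t → isVertex t ∧ lookup t x ∧ lookup t y ∧ X t)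

ov₂-comm : (X : Subset n → Bool) (x y : Fin n) → ov₂ X x y ≡ ov₂ X y x
ov₂-comm X x y = begin
  ov₂ X x y                  ≡⟨ ov₂≡sumSubsets-through X x y ⟩
  sumSubsets (through X x y) ≡⟨ sumSubsets-cong (λ t → cong bit (swap (isVertex t) (lookup t x) (lookup t y) (X t))) ⟩
  sumSubsets (through X y x) ≡⟨ ov₂≡sumSubsets-through X y x ⟨
  ov₂ X y x                  ∎
  where
  open ≡-Reasoning
  swap : ∀ v a b p → v ∧ a ∧ b ∧ p ≡ v ∧ b ∧ a ∧ p
  swap false a b p = refl
  swap true true true p = refl
  swap true true false p = refl
  swap true false true p = refl
  swap true false false p = refl

-- The only vertex through x, y and e is {x, y, e}.
sumSubsets-through-∋ : (X : Subset n → Bool) {x y e : Fin n} → Distinct3 x y e →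
  sumSubsets (λ t → through X x y t * indicator t e) ≡ ov X x y e
sumSubsets-through-∋ X {x} {y} {e} xye = trans (sumSubsets-unique (triple x y e) _ elsewhere) at-triple
  where
  elsewhere : ∀ t → t ≢ triple x y e → through X x y t * indicator t e ≡ 0
  elsewhere t t≢xye
    with isVertex t in isV | lookup t x in t∋x | lookup t y in t∋y | X t | lookup t e in t∋e
  ... | false | _ | _ | _ | _ = refl
  ... | true | false | _ | _ | _ = refl
  ... | true | true | false | _ | _ = refl
  ... | true | true | true | false | _ = refl
  ... | true | true | true | true | false = refl
  ... | true | true | true | true | true =
    ⊥-elim (t≢xye (⊇triple⇒≡triple t xye (isVertex⇒∣∣≡3 t isV) t∋x t∋y t∋e))
  at-triple : through X x y (triple x y e) * indicator (triple x y e) e ≡ ov X x y e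
  at-triple rewrite isVertex-triple xye | triple∋₁ x y e | triple∋₂ x y e | triple∋₃ x y e =
    *-identityʳ _

-- Each vertex through x ≠ y has exactly one further point e, so it is counted once on either side.
ov₂≡sumOutside : (X : Subset n → Bool) {x y : Fin n} → x ≢ y → ov₂ X x y ≡ sumOutside (pair x y) (ov X x y)
ov₂≡sumOutside {n} X {x} {y} x≢y = begin
  ov₂ X x y
    ≡⟨ ov₂≡sumSubsets-through X x y ⟩
  sumSubsets (through X x y)
    ≡⟨ sumSubsets-cong through≡sum ⟩
  sumSubsets (λ t → sumOutside (pair x y) (λ e → through X x y t * indicator t e))
    ≡⟨ sumSubsets-sum (λ t e → if lookup (pair x y) e then 0 else through X x y t * indicator t e) ⟩
  sum (λ e → sumSubsets (λ t → if lookup (pair x y) e then 0 else through X x y t * indicator t e))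
    ≡⟨ sum-cong-≗ count-e ⟩
  sumOutside (pair x y) (ov X x y)
    ∎
  where
  open ≡-Reasoning
  through≡sum : ∀ t → through X x y t ≡ sumOutside (pair x y) (λ e → through X x y t * indicator t e)
  through≡sum t with isVertex t in isV | lookup t x in t∋x | lookup t y in t∋y | X t
  ... | false | _ | _ | _ = sym (sumOutside-zero (pair x y) (λ _ _ → refl))
  ... | true | false | _ | _ = sym (sumOutside-zero (pair x y) (λ _ _ → refl))
  ... | true | true | false | _ = sym (sumOutside-zero (pair x y) (λ _ _ → refl))
  ... | true | true | true | false = sym (sumOutside-zero (pair x y) (λ _ _ → refl))
  ... | true | true | true | true = begin
    1                                                 ≡⟨ +-cancelˡ-≡ 2 1 _ 3≡2+rest ⟩
    sumOutside (pair x y) (indicator t)               ≡⟨ sumOutside-congʳ (pair x y) (λ e _ → sym (+-identityʳ _)) ⟩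
    sumOutside (pair x y) (λ e → 1 * indicator t e)   ∎
    where
    3≡2+rest : 3 ≡ 2 + sumOutside (pair x y) (indicator t)
    3≡2+rest = begin
      3                                                                      ≡⟨ isVertex⇒∣∣≡3 t isV ⟨
      ∣ t ∣                                                                  ≡⟨ ∣∣≡sum-indicator t ⟩
      sum (indicator t)                                                      ≡⟨ sum-split-pair (indicator t) x≢y ⟩
      indicator t x + indicator t y + sumOutside (pair x y) (indicator t)    ≡⟨ cong (λ k → k + sumOutside (pair x y) (indicator t))
                                                                                     (cong₂ _+_ (cong bit t∋x) (cong bit t∋y)) ⟩
      2 + sumOutside (pair x y) (indicator t)                                ∎
  count-e : ∀ e → sumSubsets (λ t → if lookup (pair x y) e then 0 else through X x y t * indicator t e)
                ≡ (if lookup (pair x y) e then 0 else ov X x y e)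
  count-e e with e ≟ x | e ≟ y
  ... | no e≢x | no e≢y rewrite pair∌ e≢x e≢y = sumSubsets-through-∋ X (x≢y , ≢-sym e≢x , ≢-sym e≢y)
  ... | yes refl | _ rewrite pair∋₁ e y = sum-map-zero (λ _ → refl) (allSubsets n)
  ... | no _ | yes refl rewrite pair∋₂ x e = sum-map-zero (λ _ → refl) (allSubsets n)

ov₂-split : (X : Subset n → Bool) {x y z : Fin n} → Distinct3 x y z →
  ov₂ X x y ≡ ov X x y z + sumOutside (triple x y z) (ov X x y)
ov₂-split X (x≢y , x≢z , y≢z) =
  trans (ov₂≡sumOutside X x≢y) (sumOutside-pair-split (ov X _ _) (≢-sym x≢z) (≢-sym y≢z))

ov₂+2≤n : (X : Subset n → Bool) {x y : Fin n} → x ≢ y → ov₂ X x y + 2 ≤ n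
ov₂+2≤n X {x} {y} x≢y = begin
  ov₂ X x y + 2                                  ≡⟨ cong (_+ 2) (ov₂≡sumOutside X x≢y) ⟩
  sumOutside (pair x y) (ov X x y) + 2           ≤⟨ +-monoˡ-≤ 2 (sumOutside-mono (pair x y) (λ e → bit≤1 _)) ⟩
  sumOutside (pair x y) (λ _ → 1) + 2            ≡⟨ sumOutside-pair-1 x≢y ⟩
  _                                              ∎
  where open ≤-Reasoning

ov₂+3≤n : (X : Subset n → Bool) {x y z : Fin n} → Distinct3 x y z → X (triple x y z) ≡ false →
  ov₂ X x y + 3 ≤ n
ov₂+3≤n X {x} {y} {z} xyz X[xyz]≡false = begin
  ov₂ X x y + 3                                  ≡⟨ cong (_+ 3) (ov₂-split X xyz) ⟩
  ov X x y z + sumOutside T (ov X x y) + 3       ≡⟨ cong (λ b → bit b + sumOutside T (ov X x y) + 3) X[xyz]≡false ⟩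
  sumOutside T (ov X x y) + 3                    ≤⟨ +-monoˡ-≤ 3 (sumOutside-mono T (λ e → bit≤1 _)) ⟩
  sumOutside T (λ _ → 1) + 3                     ≡⟨ sumOutside-triple-1 xyz ⟩
  _                                              ∎
  where
  open ≤-Reasoning
  T = triple x y z

ov₂>0⇒∃ : (X : Subset n → Bool) {x y : Fin n} → x ≢ y → 0 < ov₂ X x y →
  ∃ λ e → e ≢ x × e ≢ y × X (triple x y e) ≡ true
ov₂>0⇒∃ X {x} {y} x≢y 0<ov₂
  with sumOutside>0⇒∃ (pair x y) (ov X x y) (subst (0 <_) (ov₂≡sumOutside X x≢y) 0<ov₂)
... | e , pair∌e , 0<ov = e , proj₁ (pair∌⇒≢ x y pair∌e) , proj₂ (pair∌⇒≢ x y pair∌e) , bit>0⇒true 0<ov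

ov₂≡0 : (X : Subset n → Bool) {x y : Fin n} → x ≢ y →
  (∀ e → e ≢ x → e ≢ y → X (triple x y e) ≡ false) → ov₂ X x y ≡ 0
ov₂≡0 X {x} {y} x≢y X[xye]≡false = trans (ov₂≡sumOutside X x≢y) (sumOutside-zero (pair x y)
  (λ e pair∌e → cong bit (X[xye]≡false e (proj₁ (pair∌⇒≢ x y pair∌e)) (proj₂ (pair∌⇒≢ x y pair∌e)))))

-- A vertex meeting {x, y, z} in exactly two points is counted once on the left, {x, y, z} itself three times.
through-sum : ∀ v a b c p →
  bit (v ∧ a ∧ b ∧ p) + bit (v ∧ a ∧ c ∧ p) + bit (v ∧ b ∧ c ∧ p) ≡
  bit (v ∧ ⌊ bit a + bit b + bit c Data.Nat.≟ 2 ⌋ ∧ p) + 3 * (bit (v ∧ a ∧ b ∧ p) * bit c)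
through-sum false a b c p = refl
through-sum true true true true true = refl
through-sum true true true true false = refl
through-sum true true true false true = refl
through-sum true true true false false = refl
through-sum true true false true true = refl
through-sum true true false true false = refl
through-sum true true false false true = refl
through-sum true true false false false = refl
through-sum true false true true true = refl
through-sum true false true true false = refl
through-sum true false true false true = refl
through-sum true false true false false = refl
through-sum true false false true true = refl
through-sum true false false true false = refl
through-sum true false false false true = refl
through-sum true false false false false = refl

nbrs₁+3ov≡ov₂-sum : (X : Subset n → Bool) {x y z : Fin n} → Distinct3 x y z →
  nbrs₁ X (triple x y z) + 3 * ov X x y z ≡ ov₂ X x y + ov₂ X x z + ov₂ X y z
nbrs₁+3ov≡ov₂-sum {n} X {x} {y} {z} xyz = sym (begin
  ov₂ X x y + ov₂ X x z + ov₂ X y z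
    ≡⟨ cong₂ _+_ (cong₂ _+_ (ov₂≡sumSubsets-through X x y) (ov₂≡sumSubsets-through X x z)) (ov₂≡sumSubsets-through X y z) ⟩
  sumSubsets (through X x y) + sumSubsets (through X x z) + sumSubsets (through X y z)
    ≡⟨ cong (_+ sumSubsets (through X y z)) (sumSubsets-+ (through X x y) (through X x z)) ⟨
  sumSubsets (λ t → through X x y t + through X x z t) + sumSubsets (through X y z)
    ≡⟨ sumSubsets-+ (λ t → through X x y t + through X x z t) (through X y z) ⟨
  sumSubsets (λ t → through X x y t + through X x z t + through X y z t)
    ≡⟨ sumSubsets-cong pointwise ⟩
  sumSubsets (λ t → adjacent t + 3 * (through X x y t * indicator t z))
    ≡⟨ sumSubsets-+ adjacent (λ t → 3 * (through X x y t * indicator t z)) ⟩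
  sumSubsets adjacent + sumSubsets (λ t → 3 * (through X x y t * indicator t z))
    ≡⟨ cong₂ _+_ (sym (#≡sumSubsets (λ t → isVertex t ∧ adj (triple x y z) t ∧ X t)))
                 (sum-map-* 3 (λ t → through X x y t * indicator t z) (allSubsets n)) ⟩
  nbrs₁ X (triple x y z) + 3 * sumSubsets (λ t → through X x y t * indicator t z)
    ≡⟨ cong (λ k → nbrs₁ X (triple x y z) + 3 * k) (sumSubsets-through-∋ X xyz) ⟩
  nbrs₁ X (triple x y z) + 3 * ov X x y z
    ∎)
  where
  open ≡-Reasoning
  adjacent : Subset _ → ℕ
  adjacent t = bit (isVertex t ∧ adj (triple x y z) t ∧ X t)
  pointwise : ∀ t → through X x y t + through X x z t + through X y z t ≡
                    adjacent t + 3 * (through X x y t * indicator t z)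
  pointwise t rewrite ∣triple∩∣ t xyz = through-sum (isVertex t) (lookup t x) (lookup t y) (lookup t z) (X t)

-- Arithmetic

three-row-sums : ∀ {t u p q r} → t ≡ u + p + q → t ≡ u + p + r → t ≡ u + q + r → t ≡ u + p + p
three-row-sums {t} {u} {p} {q} {r} t≡upq t≡upr t≡uqr = trans t≡upq (cong (u + p +_) (sym p≡q))
  where
  p≡q : p ≡ q
  p≡q = +-cancelˡ-≡ u p q (+-cancelʳ-≡ r (u + p) (u + q) (trans (sym t≡upr) t≡uqr))

doubled-cancel : ∀ {u v w} → u + w + w ≡ u + v + v → w ≡ v
doubled-cancel {u} {v} {w} eq =
  trans (n≡⌊n+n/2⌋ w) (trans (cong ⌊_/2⌋ w+w≡v+v) (sym (n≡⌊n+n/2⌋ v)))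
  where
  w+w≡v+v : w + w ≡ v + v
  w+w≡v+v = +-cancelˡ-≡ u (w + w) (v + v) (trans (sym (+-assoc u w w)) (trans eq (+-assoc u v v)))

row-gap : ∀ {p q u v n} → p + 3 ≡ u + u + u → q ≡ u + v + v → p + 7 ≡ q + n → 2 * u + 4 ≡ 2 * v + n
row-gap {p} {q} {u} {v} {n} p+3≡3u q≡u+2v p+7≡q+n = +-cancelˡ-≡ u _ _ (begin
  u + (2 * u + 4)       ≡⟨ lhs u ⟩
  u + u + u + 4         ≡⟨ cong (_+ 4) p+3≡3u ⟨
  p + 3 + 4             ≡⟨ +-assoc p 3 4 ⟩
  p + 7                 ≡⟨ p+7≡q+n ⟩
  q + n                 ≡⟨ cong (_+ n) q≡u+2v ⟩
  u + v + v + n         ≡⟨ rhs u v n ⟩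
  u + (2 * v + n)       ∎)
  where
  open ≡-Reasoning
  lhs : ∀ u → u + (2 * u + 4) ≡ u + u + u + 4
  lhs = solve-∀
  rhs : ∀ u v n → u + v + v + n ≡ u + (2 * v + n)
  rhs = solve-∀

typeII-gaps : ∀ {u v d n} → u + u + u ≡ v + u + d → 2 * u + 4 ≡ 2 * v + n → 4 ≤ n →
  v ≤ u × u ≤ d × 2 * d + 4 ≡ 2 * u + n
typeII-gaps {u} {v} {d} {n} 3u≡v+u+d gap 4≤n = v≤u , u≤d , upper-gap
  where
  open ≡-Reasoning
  u+u≡v+d : u + u ≡ v + d
  u+u≡v+d = +-cancelˡ-≡ u _ _ (trans (sym (+-assoc u u u)) (trans 3u≡v+u+d (shuffle v u d)))
    where
    shuffle : ∀ v u d → v + u + d ≡ u + (v + d)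
    shuffle = solve-∀
  v≤u : v ≤ u
  v≤u = *-cancelˡ-≤ 2 (+-cancelʳ-≤ n (2 * v) (2 * u)
          (subst (_≤ 2 * u + n) gap (+-monoʳ-≤ (2 * u) 4≤n)))
  u≤d : u ≤ d
  u≤d = +-cancelˡ-≤ u u d (subst (_≤ u + d) (sym u+u≡v+d) (+-monoˡ-≤ d v≤u))
  upper-gap : 2 * d + 4 ≡ 2 * u + n
  upper-gap = +-cancelˡ-≡ (2 * v) _ _ (begin
    2 * v + (2 * d + 4)     ≡⟨ lhs v d ⟩
    2 * (v + d) + 4         ≡⟨ cong (λ k → 2 * k + 4) u+u≡v+d ⟨
    2 * (u + u) + 4         ≡⟨ mid u ⟩
    2 * u + (2 * u + 4)     ≡⟨ cong (2 * u +_) gap ⟩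
    2 * u + (2 * v + n)     ≡⟨ rhs u v n ⟩
    2 * v + (2 * u + n)     ∎)
    where
    lhs : ∀ v d → 2 * v + (2 * d + 4) ≡ 2 * (v + d) + 4
    lhs = solve-∀
    mid : ∀ u → 2 * (u + u) + 4 ≡ 2 * u + (2 * u + 4)
    mid = solve-∀
    rhs : ∀ u v n → 2 * u + (2 * v + n) ≡ 2 * v + (2 * u + n)
    rhs = solve-∀

row-gap⇒≤2 : ∀ {u v d n} → u + u + u ≡ v + v + d → 2 * u + 4 ≡ 2 * v + n → d + 2 ≤ n → u ≤ 2
row-gap⇒≤2 {u} {v} {d} {n} 3u≡2v+d gap d+2≤n = +-cancelˡ-≤ (2 * u) u 2 (+-cancelʳ-≤ 2 _ _ (begin
  2 * u + u + 2          ≡⟨ lhs u ⟩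
  u + u + u + 2          ≡⟨ cong (_+ 2) 3u≡2v+d ⟩
  v + v + d + 2          ≡⟨ mid v d ⟩
  2 * v + (d + 2)        ≤⟨ +-monoʳ-≤ (2 * v) d+2≤n ⟩
  2 * v + n              ≡⟨ gap ⟨
  2 * u + 4              ≡⟨ +-assoc (2 * u) 2 2 ⟨
  2 * u + 2 + 2          ∎))
  where
  open ≤-Reasoning
  lhs : ∀ u → 2 * u + u + 2 ≡ u + u + u + 2
  lhs = solve-∀
  mid : ∀ v d → v + v + d + 2 ≡ 2 * v + (d + 2)
  mid = solve-∀

small-row⇒n≤5 : ∀ {p u n} → p + 3 ≡ u + u + u → u ≤ 2 → 2 * n ≤ p + 7 → n ≤ 5
small-row⇒n≤5 {p} {u} {n} p+3≡3u u≤2 2n≤p+7 = *-cancelˡ-≤ 2 (begin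
  2 * n                  ≤⟨ 2n≤p+7 ⟩
  p + 7                  ≡⟨ +-assoc p 3 4 ⟨
  p + 3 + 4              ≡⟨ cong (_+ 4) p+3≡3u ⟩
  u + u + u + 4          ≤⟨ +-monoˡ-≤ 4 (+-mono-≤ (+-mono-≤ u≤2 u≤2) u≤2) ⟩
  10                     ∎)
  where open ≤-Reasoning

vanishing-gap-contradiction : ∀ {p u n} → p + 3 ≡ u + u + u → 2 * u + 4 ≡ n → 2 * n ≤ p + 7 → ⊥
vanishing-gap-contradiction {p} {u} {n} p+3≡3u 2u+4≡n 2n≤p+7 = m+1+n≰m (u + u + u + 4) (begin
  u + u + u + 4 + suc (u + 3)   ≡⟨ rearrange u ⟩
  2 * (2 * u + 4)               ≡⟨ cong (2 *_) 2u+4≡n ⟩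
  2 * n                         ≤⟨ 2n≤p+7 ⟩
  p + 7                         ≡⟨ +-assoc p 3 4 ⟨
  p + 3 + 4                     ≡⟨ cong (_+ 4) p+3≡3u ⟩
  u + u + u + 4                 ∎)
  where
  open ≤-Reasoning
  rearrange : ∀ u → u + u + u + 4 + suc (u + 3) ≡ 2 * (2 * u + 4)
  rearrange = solve-∀

large-row-contradiction : ∀ {u s t r n} → u + u + u ≡ s + t + r → u + 2 ≡ n →
  s + 3 ≤ n → t + 2 ≤ n → r + 2 ≤ n → ⊥
large-row-contradiction {u} {s} {t} {r} {n} 3u≡s+t+r u+2≡n s+3≤n t+2≤n r+2≤n =
  m+1+n≰m (u + u + u + 6) {0} (begin
    u + u + u + 6 + 1          ≡⟨ +-assoc (u + u + u) 6 1 ⟩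
    u + u + u + 7              ≡⟨ cong (_+ 7) 3u≡s+t+r ⟩
    s + t + r + 7              ≡⟨ regroup s t r ⟩
    (s + 3) + (t + 2) + (r + 2) ≤⟨ +-mono-≤ (+-mono-≤ s+3≤n t+2≤n) r+2≤n ⟩
    n + n + n                  ≡⟨ cong (λ k → k + k + k) u+2≡n ⟨
    (u + 2) + (u + 2) + (u + 2) ≡⟨ collect u ⟩
    u + u + u + 6              ∎)
  where
  open ≤-Reasoning
  regroup : ∀ s t r → s + t + r + 7 ≡ (s + 3) + (t + 2) + (r + 2)
  regroup = solve-∀
  collect : ∀ u → (u + 2) + (u + 2) + (u + 2) ≡ u + u + u + 6
  collect = solve-∀

empty-row-contradiction : ∀ {p u n} → p + 3 ≡ u + u + u → u + 2 ≡ n → p + 7 ≡ 0 + n → ⊥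
empty-row-contradiction {p} {u} {n} p+3≡3u u+2≡n p+7≡n = m+1+n≢m (u + 2) (begin
  u + 2 + suc (u + u + 1)    ≡⟨ rearrange u ⟩
  u + u + u + 4              ≡⟨ cong (_+ 4) p+3≡3u ⟨
  p + 3 + 4                  ≡⟨ +-assoc p 3 4 ⟩
  p + 7                      ≡⟨ p+7≡n ⟩
  n                          ≡⟨ u+2≡n ⟨
  u + 2                      ∎)
  where
  open ≡-Reasoning
  rearrange : ∀ u → u + 2 + suc (u + u + 1) ≡ u + u + u + 4
  rearrange = solve-∀

-- The configuration around {a, b, c}

module _ {X₁ : Subset n → Bool} {p₁₁ p₁₂ p₂₁ p₂₂ : ℕ} (E : Equitable n X₁ p₁₁ p₁₂ p₂₁ p₂₂) where
  open Equitable E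

  rowTotal : Bool → ℕ
  rowTotal true = p₁₁ + 3
  rowTotal false = p₂₁

  rowTotal≡ov₂-sum : {x y z : Fin n} → Distinct3 x y z →
    rowTotal (X₁ (triple x y z)) ≡ ov₂ X₁ x y + ov₂ X₁ x z + ov₂ X₁ y z
  rowTotal≡ov₂-sum {x} {y} {z} xyz with X₁ (triple x y z) in X₁xyz
  ... | true = trans (cong₂ _+_ (sym (proj₁ (row₁ _ (∣triple∣≡3 xyz) X₁xyz))) (cong (λ b → 3 * bit b) (sym X₁xyz)))
                     (nbrs₁+3ov≡ov₂-sum X₁ xyz)
  ... | false = trans (sym (+-identityʳ p₂₁))
                  (trans (cong₂ _+_ (sym (proj₁ (row₂ _ (∣triple∣≡3 xyz) X₁xyz))) (cong (λ b → 3 * bit b) (sym X₁xyz)))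
                         (nbrs₁+3ov≡ov₂-sum X₁ xyz))

module Configuration
  {X₁ : Subset n → Bool} {p₁₁ p₁₂ p₂₁ p₂₂ : ℕ} (E : Equitable n X₁ p₁₁ p₁₂ p₂₁ p₂₂)
  (λ₂ : p₁₁ + 7 ≡ p₂₁ + n) (p₁₁-large : 2 * n ≤ p₁₁ + 7) (no-types : NoTypeI-II n X₁)
  {a b c : Fin n} (abc : Distinct3 a b c) (X₁abc : X₁ (triple a b c) ≡ true)
  (uniform : ∀ d → d ∉ triple a b c →
    X₁ (triple a c d) ≡ X₁ (triple a b d) × X₁ (triple b c d) ≡ X₁ (triple a b d))
  where

  open Equitable E using (nonempty₂)

  T : Subset n
  T = triple a b c

  U : ℕ
  U = ov₂ X₁ a b

  a≢b : a ≢ b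
  a≢b = proj₁ abc

  a≢c : a ≢ c
  a≢c = proj₁ (proj₂ abc)

  b≢c : b ≢ c
  b≢c = proj₂ (proj₂ abc)

  ov₂-agrees : {x y z : Fin n} → Distinct3 x y z → triple x y z ≡ T →
    (∀ d → d ∉ T → X₁ (triple x y d) ≡ X₁ (triple a b d)) → ov₂ X₁ x y ≡ U
  ov₂-agrees {x} {y} {z} xyz xyz≡T agree = begin
    ov₂ X₁ x y                                        ≡⟨ ov₂-split X₁ xyz ⟩
    bit (X₁ (triple x y z)) + sumOutside (triple x y z) (ov X₁ x y)
      ≡⟨ cong (λ s → bit (X₁ s) + sumOutside s (ov X₁ x y)) xyz≡T ⟩
    ov X₁ a b c + sumOutside T (ov X₁ x y)
      ≡⟨ cong (ov X₁ a b c +_) (sumOutside-congʳ T (λ d T∌d → cong bit (agree d (lookup≡false⇒∉ T∌d)))) ⟩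
    ov X₁ a b c + sumOutside T (ov X₁ a b)            ≡⟨ ov₂-split X₁ abc ⟨
    U                                                 ∎
    where open ≡-Reasoning

  ov₂-ac≡U : ov₂ X₁ a c ≡ U
  ov₂-ac≡U = ov₂-agrees (a≢c , a≢b , ≢-sym b≢c) (sym (triple-swap₂₃ a b c)) (λ d d∉T → proj₁ (uniform d d∉T))

  ov₂-bc≡U : ov₂ X₁ b c ≡ U
  ov₂-bc≡U = ov₂-agrees (b≢c , ≢-sym a≢b , ≢-sym a≢c) (sym (triple-rotate a b c)) (λ d d∉T → proj₂ (uniform d d∉T))

  p₁₁+3≡3U : p₁₁ + 3 ≡ U + U + U
  p₁₁+3≡3U = trans (cong (rowTotal E) (sym X₁abc))
               (trans (rowTotal≡ov₂-sum E abc) (cong₂ (λ u v → U + u + v) ov₂-ac≡U ov₂-bc≡U))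

  link : ∀ d → d ∉ T → rowTotal E (X₁ (triple a b d)) ≡ U + ov₂ X₁ a d + ov₂ X₁ a d
  link d d∉T = three-row-sums {u = U} {ov₂ X₁ a d} {ov₂ X₁ b d} {ov₂ X₁ c d} abd
    (trans (cong (rowTotal E) (sym X₁acd≡X₁abd)) acd)
    (trans (cong (rowTotal E) (sym X₁bcd≡X₁abd)) bcd)
    where
    d≢a : d ≢ a
    d≢a = proj₁ (∉triple⇒≢ d∉T)
    d≢b : d ≢ b
    d≢b = proj₁ (proj₂ (∉triple⇒≢ d∉T))
    d≢c : d ≢ c
    d≢c = proj₂ (proj₂ (∉triple⇒≢ d∉T))
    X₁acd≡X₁abd : X₁ (triple a c d) ≡ X₁ (triple a b d)
    X₁acd≡X₁abd = proj₁ (uniform d d∉T)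
    X₁bcd≡X₁abd : X₁ (triple b c d) ≡ X₁ (triple a b d)
    X₁bcd≡X₁abd = proj₂ (uniform d d∉T)
    abd : rowTotal E (X₁ (triple a b d)) ≡ U + ov₂ X₁ a d + ov₂ X₁ b d
    abd = rowTotal≡ov₂-sum E (a≢b , ≢-sym d≢a , ≢-sym d≢b)
    acd : rowTotal E (X₁ (triple a c d)) ≡ U + ov₂ X₁ a d + ov₂ X₁ c d
    acd = trans (rowTotal≡ov₂-sum E (a≢c , ≢-sym d≢a , ≢-sym d≢c))
                (cong (λ u → u + ov₂ X₁ a d + ov₂ X₁ c d) ov₂-ac≡U)
    bcd : rowTotal E (X₁ (triple b c d)) ≡ U + ov₂ X₁ b d + ov₂ X₁ c d
    bcd = trans (rowTotal≡ov₂-sum E (b≢c , ≢-sym d≢b , ≢-sym d≢c))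
                (cong (λ u → u + ov₂ X₁ b d + ov₂ X₁ c d) ov₂-bc≡U)

  module SomeAbdInX₂ {d : Fin n} (d∉T : d ∉ T) (X₁abd : X₁ (triple a b d) ≡ false) (6≤n : 6 ≤ n) where

    V : ℕ
    V = ov₂ X₁ a d

    d≢a : d ≢ a
    d≢a = proj₁ (∉triple⇒≢ d∉T)

    p₂₁≡U+2V : p₂₁ ≡ U + V + V
    p₂₁≡U+2V = trans (cong (rowTotal E) (sym X₁abd)) (link d d∉T)

    gap : 2 * U + 4 ≡ 2 * V + n
    gap = row-gap {u = U} {V} p₁₁+3≡3U p₂₁≡U+2V λ₂

    ade-row : ∀ {e} → e ∉ T → e ≢ d → X₁ (triple a d e) ≡ true → p₁₁ + 3 ≡ V + ov₂ X₁ a e + ov₂ X₁ d e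
    ade-row e∉T e≢d X₁ade = trans (cong (rowTotal E) (sym X₁ade))
      (rowTotal≡ov₂-sum E (≢-sym d≢a , ≢-sym (proj₁ (∉triple⇒≢ e∉T)) , ≢-sym e≢d))

    -- A further vertex {a, d, e} in X₁ would be of type (II) or would force n ≤ 5.
    ade∉X₁ : ∀ {e} → e ∉ T → e ≢ d → X₁ (triple a d e) ≢ true
    ade∉X₁ {e} e∉T e≢d X₁ade with X₁ (triple a b e) in X₁abe
    ... | true = proj₂ (no-types e d a (e≢d , e≢a , d≢a) X₁eda ea≤ed da≤ea) typeII
      where
      e≢a : e ≢ a
      e≢a = proj₁ (∉triple⇒≢ e∉T)
      ae≡U : ov₂ X₁ a e ≡ U
      ae≡U = doubled-cancel {U} {U} (trans (sym (trans (cong (rowTotal E) (sym X₁abe)) (link e e∉T))) p₁₁+3≡3U)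
      gaps : V ≤ U × U ≤ ov₂ X₁ d e × 2 * ov₂ X₁ d e + 4 ≡ 2 * U + n
      gaps = typeII-gaps {U} {V} {ov₂ X₁ d e}
        (trans (sym p₁₁+3≡3U) (trans (ade-row e∉T e≢d X₁ade) (cong (λ w → V + w + ov₂ X₁ d e) ae≡U)))
        gap (≤-trans (m≤m+n 4 2) 6≤n)
      X₁eda : X₁ (triple e d a) ≡ true
      X₁eda = trans (cong X₁ (sym (trans (triple-swap₁₂ a d e) (trans (triple-swap₂₃ d a e) (triple-swap₁₂ d e a))))) X₁ade
      ea≡U : ov₂ X₁ e a ≡ U
      ea≡U = trans (ov₂-comm X₁ e a) ae≡U
      ed≡de : ov₂ X₁ e d ≡ ov₂ X₁ d e
      ed≡de = ov₂-comm X₁ e d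
      da≡V : ov₂ X₁ d a ≡ V
      da≡V = ov₂-comm X₁ d a
      ea≤ed : ov₂ X₁ e a ≤ ov₂ X₁ e d
      ea≤ed = subst₂ _≤_ (sym ea≡U) (sym ed≡de) (proj₁ (proj₂ gaps))
      da≤ea : ov₂ X₁ d a ≤ ov₂ X₁ e a
      da≤ea = subst₂ _≤_ (sym da≡V) (sym ea≡U) (proj₁ gaps)
      typeII : TypeII n X₁ e d a
      typeII = trans (cong (λ k → 2 * k + 4) ed≡de) (trans (proj₂ (proj₂ gaps)) (cong (λ k → 2 * k + n) (sym ea≡U))) ,
               trans (cong (λ k → 2 * k + 4) ea≡U) (trans gap (cong (λ k → 2 * k + n) (sym da≡V)))
    ... | false = <⇒≱ 6≤n (small-row⇒n≤5 {u = U} p₁₁+3≡3U U≤2 p₁₁-large)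
      where
      ae≡V : ov₂ X₁ a e ≡ V
      ae≡V = doubled-cancel {U} {V} (trans (sym (trans (cong (rowTotal E) (sym X₁abe)) (link e e∉T))) p₂₁≡U+2V)
      U≤2 : U ≤ 2
      U≤2 = row-gap⇒≤2 {U} {V} {ov₂ X₁ d e}
        (trans (sym p₁₁+3≡3U) (trans (ade-row e∉T e≢d X₁ade) (cong (λ w → V + w + ov₂ X₁ d e) ae≡V)))
        gap (ov₂+2≤n X₁ (≢-sym e≢d))

    V≡0 : V ≡ 0
    V≡0 = ov₂≡0 X₁ (≢-sym d≢a) ade≡false
      where
      ade≡false : ∀ e → e ≢ a → e ≢ d → X₁ (triple a d e) ≡ false
      ade≡false e e≢a e≢d with e ≟ b | e ≟ c
      ... | yes refl | _ = trans (cong X₁ (triple-swap₂₃ a d e)) X₁abd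
      ... | no _ | yes refl = trans (cong X₁ (triple-swap₂₃ a d e)) (trans (proj₁ (uniform d d∉T)) X₁abd)
      ... | no e≢b | no e≢c with X₁ (triple a d e) in X₁ade
      ...   | false = refl
      ...   | true = ⊥-elim (ade∉X₁ (lookup≡false⇒∉ (triple∌ e≢a e≢b e≢c)) e≢d X₁ade)

    contradiction : ⊥
    contradiction = vanishing-gap-contradiction {u = U} p₁₁+3≡3U (trans gap (cong (λ v → 2 * v + n) V≡0)) p₁₁-large

  module AllAbdInX₁ (X₁abd : ∀ d → d ∉ T → X₁ (triple a b d) ≡ true) where

    U+2≡n : U + 2 ≡ n
    U+2≡n = begin
      U + 2                                         ≡⟨ cong (_+ 2) (ov₂-split X₁ abc) ⟩
      ov X₁ a b c + sumOutside T (ov X₁ a b) + 2    ≡⟨ cong (λ k → bit (X₁ T) + k + 2)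
                                                         (sumOutside-congʳ T (λ d T∌d → cong bit (X₁abd d (lookup≡false⇒∉ T∌d)))) ⟩
      bit (X₁ T) + sumOutside T (λ _ → 1) + 2       ≡⟨ cong (λ β → bit β + sumOutside T (λ _ → 1) + 2) X₁abc ⟩
      suc (sumOutside T (λ _ → 1) + 2)              ≡⟨ +-suc (sumOutside T (λ _ → 1)) 2 ⟨
      sumOutside T (λ _ → 1) + 3                    ≡⟨ sumOutside-triple-1 abc ⟩
      n                                             ∎
      where open ≡-Reasoning

    -- Here U = n - 2, so a vertex {x, y, e} of X₁ has ov₂ sum 3n - 6, while ov₂ x y ≤ n - 3 caps it at 3n - 7.
    ov₂≡0-in-X₂ : {x y z : Fin n} → Distinct3 x y z → X₁ (triple x y z) ≡ false → ov₂ X₁ x y ≡ 0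
    ov₂≡0-in-X₂ {x} {y} {z} xyz@(x≢y , _ , _) X₁xyz with 0 <? ov₂ X₁ x y
    ... | no ov₂≯0 = n≤0⇒n≡0 (≮⇒≥ ov₂≯0)
    ... | yes 0<ov₂ with ov₂>0⇒∃ X₁ x≢y 0<ov₂
    ...   | e , e≢x , e≢y , X₁xye = ⊥-elim (large-row-contradiction {U} {ov₂ X₁ x y}
              (trans (sym p₁₁+3≡3U) (trans (cong (rowTotal E) (sym X₁xye)) (rowTotal≡ov₂-sum E (x≢y , ≢-sym e≢x , ≢-sym e≢y))))
              U+2≡n (ov₂+3≤n X₁ xyz X₁xyz) (ov₂+2≤n X₁ (≢-sym e≢x)) (ov₂+2≤n X₁ (≢-sym e≢y)))

    p₂₁≡0 : {x y z : Fin n} → Distinct3 x y z → X₁ (triple x y z) ≡ false → p₂₁ ≡ 0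
    p₂₁≡0 {x} {y} {z} xyz@(x≢y , x≢z , y≢z) X₁xyz =
      trans (trans (cong (rowTotal E) (sym X₁xyz)) (rowTotal≡ov₂-sum E xyz))
        (cong₂ _+_ (cong₂ _+_ (ov₂≡0-in-X₂ xyz X₁xyz)
                              (ov₂≡0-in-X₂ (x≢z , x≢y , ≢-sym y≢z) (trans (cong X₁ (sym (triple-swap₂₃ x y z))) X₁xyz)))
                   (ov₂≡0-in-X₂ (y≢z , ≢-sym x≢y , ≢-sym x≢z) (trans (cong X₁ (sym (triple-rotate x y z))) X₁xyz)))

    contradiction : ⊥
    contradiction =
      let s , ∣s∣≡3 , X₁s = nonempty₂
          x , y , z , xyz , s≡xyz = 3-subset⇒triple s ∣s∣≡3
      in empty-row-contradiction {u = U} p₁₁+3≡3U U+2≡n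
           (trans λ₂ (cong (_+ n) (p₂₁≡0 xyz (trans (cong X₁ (sym s≡xyz)) X₁s))))

  n≤5 : n ≤ 5
  n≤5 with any? (λ d → ¬? (d ∈? T) ×-dec (X₁ (triple a b d) Bool.≟ false))
  ... | yes (d , d∉T , X₁abd) with n ≤? 5
  ...   | yes n≤5 = n≤5
  ...   | no n≰5 = ⊥-elim (SomeAbdInX₂.contradiction d∉T X₁abd (≰⇒> n≰5))
  n≤5 | no ¬∃ = ⊥-elim (AllAbdInX₁.contradiction X₁abd)
    where
    X₁abd : ∀ d → d ∉ T → X₁ (triple a b d) ≡ true
    X₁abd d d∉T with X₁ (triple a b d) in eq
    ... | true = refl
    ... | false = ⊥-elim (¬∃ (d , d∉T , eq))

mainTheorem20 : (n : ℕ) (X₁ : Subset n → Bool) (p₁₁ p₁₂ p₂₁ p₂₂ : ℕ) →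
    λ₂-Equitable n X₁ p₁₁ p₁₂ p₂₁ p₂₂ →
    p₂₂ ≤ p₁₁ → 2 * n ≤ p₁₁ + 7 →
    NoTypeI-II n X₁ →
    (a b c : Fin n) → Distinct3 a b c → ov X₁ a b c ≡ 1 →
    (∀ (d : Fin n) → d ∉ triple a b c →
      (ov X₁ a b d ≡ 1 × ov X₁ a c d ≡ 1 × ov X₁ b c d ≡ 1) ⊎
      (ov X₁ a b d ≡ 0 × ov X₁ a c d ≡ 0 × ov X₁ b c d ≡ 0)) →
    n ≤ 14
mainTheorem20 n X₁ p₁₁ p₁₂ p₂₁ p₂₂ (E , λ₂) _ p₁₁-large no-types a b c abc ov-abc≡1 monochrome =
  ≤-trans (Configuration.n≤5 E λ₂ p₁₁-large no-types abc (bit≡1⇒true ov-abc≡1) uniform) (m≤m+n 5 9)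
  where
  uniform : ∀ d → d ∉ triple a b c →
    X₁ (triple a c d) ≡ X₁ (triple a b d) × X₁ (triple b c d) ≡ X₁ (triple a b d)
  uniform d d∉T with monochrome d d∉T
  ... | inj₁ (ab , ac , bc) = bit-injective (trans ac (sym ab)) , bit-injective (trans bc (sym ab))
  ... | inj₂ (ab , ac , bc) = bit-injective (trans ac (sym ab)) , bit-injective (trans bc (sym ab))
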